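{- Suppose $(\lambda,\mu)\in{\sf Kostka}_r^{\mathbb Z}$, $\lambda_1=r$, and $\mu$ is a rectangle. If $\lambda$ is not a rectangle, then $(\lambda,\mu)$ is not a Hilbert basis element of ${\sf Kostka}_r^{\mathbb Z}$.
   Context: ${\sf Kostka}_r^{\mathbb Z}$ is the semigroup (componentwise addition) of pairs $(\lambda,\mu)$ of partitions with at most $r$ nonzero parts, $|\lambda|=|\mu|$, and $\sum_{i\le t}\lambda_i\ge\sum_{i\le t}\mu_i$ for all $t$. Its Hilbert basis is the set of nonzero elements not expressible as a sum of two nonzero elements. A partition is a rectangle if all of its nonzero parts are equal. -}

module Defs where

open import Data.Nat using (ℕ; zero; suc; _+_; _≤_)
open import Data.Fin using (Fin)
import Data.Fin as Fin
open import Data.Vec using (Vec; lookup; zipWith; replicate; toList)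
import Data.List as List
open import Data.Nat.ListAction using (sum)
open import Data.Product using (Σ; _×_; _,_; ∃)
open import Relation.Binary.PropositionalEquality using (_≡_; _≢_)
open import Relation.Nullary using (¬_)

-- A partition with at most r nonzero parts, written as a weakly
-- decreasing vector of length r (padded with zeros).
IsPartition : {r : ℕ} → Vec ℕ r → Set
IsPartition {r} v = (i j : Fin r) → i Fin.≤ j → lookup v j ≤ lookup v i

size : {r : ℕ} → Vec ℕ r → ℕ
size v = sum (toList v)

psum : {r : ℕ} → ℕ → Vec ℕ r → ℕ
psum t v = sum (List.take t (toList v))

InKostka : (r : ℕ) → Vec ℕ r → Vec ℕ r → Set
InKostka r l m =
  IsPartition l × IsPartition m × size l ≡ size m ×
  ((t : ℕ) → psum t m ≤ psum t l)

zeroV : {r : ℕ} → Vec ℕ r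
zeroV = replicate _ 0

_⊕_ : {r : ℕ} → Vec ℕ r → Vec ℕ r → Vec ℕ r
_⊕_ = zipWith _+_

IsZeroPair : {r : ℕ} → Vec ℕ r → Vec ℕ r → Set
IsZeroPair l m = (l ≡ zeroV) × (m ≡ zeroV)

IsHilbertBasis : (r : ℕ) → Vec ℕ r → Vec ℕ r → Set
IsHilbertBasis r l m =
  InKostka r l m × ¬ IsZeroPair l m ×
  ¬ (Σ (Vec ℕ r) λ l₁ → Σ (Vec ℕ r) λ m₁ → Σ (Vec ℕ r) λ l₂ → Σ (Vec ℕ r) λ m₂ →
       InKostka r l₁ m₁ × ¬ IsZeroPair l₁ m₁ ×
       InKostka r l₂ m₂ × ¬ IsZeroPair l₂ m₂ ×
       l ≡ l₁ ⊕ l₂ × m ≡ m₁ ⊕ m₂)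

IsRectangle : {r : ℕ} → Vec ℕ r → Set
IsRectangle {r} v = (i j : Fin r) → lookup v i ≢ 0 → lookup v j ≢ 0 → lookup v i ≡ lookup v j

-- Write μ = c^k. Since λ dominates μ and |λ| = ck, λ has at most k nonzero parts, so its
-- columns have heights h₀ ≥ … ≥ h_{r−1} with 1 ≤ h_j ≤ k (there are r of them as λ₁ = r),
-- and h_{r−1} < h₀ because λ is not a rectangle. If the columns in a set A have total height
-- ak, then the columns in A and those outside A form partitions λ^A, λ^B with
-- (λ^A, a^k), (λ^B, b^k) ∈ Kostka: a column of height h ≤ k contributes min(t, h) ≥ min(t, k) h / k
-- to the t-th partial sum. Taking A neither empty nor all columns, this decomposes (λ, μ).
-- Such an A exists by the pigeonhole principle applied to the residues mod k of the total
-- heights of k + 1 suitable column sets.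

module Submission where

open import Defs
open import Data.Nat
  using ( ℕ; zero; suc; _+_; _*_; _∸_; _⊓_; _%_; _/_; _≤_; _<_; _≟_; _<?_
        ; z≤n; s≤s; z<s; s<s; s<s⁻¹; s≤s⁻¹; NonZero; ≢-nonZero; >-nonZero)
open import Data.Nat.Properties
open import Data.Nat.DivMod using (m≡m%n+[m/n]*n; _mod_)
open import Data.Nat.Divisibility using (_∣_; divides; ∣⇒≤; ∣m+n∣m⇒∣n; n∣m*n)
open import Data.Fin using (Fin; toℕ; fromℕ<)
import Data.Fin as Fin
open import Data.Fin.Properties using (toℕ-fromℕ<; toℕ<n; pigeonhole)
open import Data.Vec using (Vec; []; _∷_; lookup; head)
open import Data.Product using (Σ; ∃; ∃₂; _×_; _,_; proj₁; proj₂)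
open import Data.Sum using (inj₁; inj₂; [_,_]; map₂)
open import Function using (_∘_; _⇔_; mk⇔; Equivalence)
open import Level using (0ℓ)
open import Relation.Binary.Definitions using (Antitonic₁)
open import Relation.Binary.PropositionalEquality
  using (_≡_; _≢_; refl; sym; trans; cong; cong₂; subst; subst₂; module ≡-Reasoning)
open import Relation.Nullary using (¬_; Dec; yes; no; ¬?; contradiction)
open import Relation.Nullary.Decidable using (_×-dec_)
open import Relation.Unary using (Pred; Decidable; _⊆_; _∪_; ∅)
open import Relation.Unary.Properties using (_∪?_; _∩?_; ∁?; ∅?)
open import Algebra.Properties.CommutativeSemigroup +-commutativeSemigroup
  using () renaming (interchange to +-interchange)
open import Algebra.Properties.CommutativeSemigroup *-commutativeSemigroup
  using () renaming (x∙yz≈y∙xz to *-left-comm)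

open Equivalence using (to; from)

∑< : ℕ → (ℕ → ℕ) → ℕ
∑< zero    f = 0
∑< (suc t) f = f 0 + ∑< t (f ∘ suc)

syntax ∑< t (λ i → e) = ∑[ i < t ] e

∑-cong : ∀ t {f g : ℕ → ℕ} → (∀ i → i < t → f i ≡ g i) → ∑< t f ≡ ∑< t g
∑-cong zero    f≡g = refl
∑-cong (suc t) f≡g = cong₂ _+_ (f≡g 0 z<s) (∑-cong t (λ i i<t → f≡g (suc i) (s<s i<t)))

∑-mono-≤ : ∀ t {f g : ℕ → ℕ} → (∀ i → i < t → f i ≤ g i) → ∑< t f ≤ ∑< t g
∑-mono-≤ zero    f≤g = z≤n
∑-mono-≤ (suc t) f≤g = +-mono-≤ (f≤g 0 z<s) (∑-mono-≤ t (λ i i<t → f≤g (suc i) (s<s i<t)))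

∑-zero : ∀ t → ∑[ i < t ] 0 ≡ 0
∑-zero zero    = refl
∑-zero (suc t) = ∑-zero t

∑-distrib-+ : ∀ t (f g : ℕ → ℕ) → ∑[ i < t ] (f i + g i) ≡ ∑< t f + ∑< t g
∑-distrib-+ zero    f g = refl
∑-distrib-+ (suc t) f g = trans (cong (f 0 + g 0 +_) (∑-distrib-+ t (f ∘ suc) (g ∘ suc)))
                                (+-interchange (f 0) (g 0) _ _)

∑-distribˡ-* : ∀ t c (f : ℕ → ℕ) → ∑[ i < t ] (c * f i) ≡ c * ∑< t f
∑-distribˡ-* zero    c f = sym (*-zeroʳ c)
∑-distribˡ-* (suc t) c f = trans (cong (c * f 0 +_) (∑-distribˡ-* t c (f ∘ suc)))
                                 (sym (*-distribˡ-+ c (f 0) _))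

∑-comm : ∀ s t (g : ℕ → ℕ → ℕ) → ∑[ i < s ] ∑[ j < t ] g i j ≡ ∑[ j < t ] ∑[ i < s ] g i j
∑-comm zero    t g = sym (∑-zero t)
∑-comm (suc s) t g = trans (cong (∑< t (g 0) +_) (∑-comm s t (g ∘ suc)))
                           (sym (∑-distrib-+ t (g 0) (λ j → ∑[ i < s ] g (suc i) j)))

∑-split : ∀ s t (f : ℕ → ℕ) → ∑< (s + t) f ≡ ∑< s f + ∑[ i < t ] f (s + i)
∑-split zero    t f = refl
∑-split (suc s) t f = trans (cong (f 0 +_) (∑-split s t (f ∘ suc))) (sym (+-assoc (f 0) _ _))

∑≡0⇒≡0 : ∀ t (f : ℕ → ℕ) → ∑< t f ≡ 0 → ∀ i → i < t → f i ≡ 0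
∑≡0⇒≡0 (suc t) f ∑≡0 zero    _         = m+n≡0⇒m≡0 (f 0) ∑≡0
∑≡0⇒≡0 (suc t) f ∑≡0 (suc i) (s<s i<t) = ∑≡0⇒≡0 t (f ∘ suc) (m+n≡0⇒n≡0 (f 0) ∑≡0) i i<t

≤-∑ : ∀ t (f : ℕ → ℕ) {i} → i < t → f i ≤ ∑< t f
≤-∑ (suc t) f {zero}  _         = m≤m+n (f 0) _
≤-∑ (suc t) f {suc i} (s<s i<t) = ≤-trans (≤-∑ t (f ∘ suc) i<t) (m≤n+m _ (f 0))

𝟙 : {P : Set} → Dec P → ℕ
𝟙 (yes _) = 1
𝟙 (no _)  = 0

𝟙-yes : {P : Set} (P? : Dec P) → P → 𝟙 P? ≡ 1
𝟙-yes (yes _) _ = refl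
𝟙-yes (no ¬p) p = contradiction p ¬p

𝟙-no : {P : Set} (P? : Dec P) → ¬ P → 𝟙 P? ≡ 0
𝟙-no (yes p) ¬p = contradiction p ¬p
𝟙-no (no _)  _  = refl

𝟙-mono : {P Q : Set} (P? : Dec P) (Q? : Dec Q) → (P → Q) → 𝟙 P? ≤ 𝟙 Q?
𝟙-mono (yes p) Q? P→Q = ≤-reflexive (sym (𝟙-yes Q? (P→Q p)))
𝟙-mono (no _)  Q? P→Q = z≤n

𝟙-cong : {P Q : Set} (P? : Dec P) (Q? : Dec Q) → P ⇔ Q → 𝟙 P? ≡ 𝟙 Q?
𝟙-cong P? Q? P⇔Q = ≤-antisym (𝟙-mono P? Q? (to P⇔Q)) (𝟙-mono Q? P? (from P⇔Q))

𝟙-∁ : {P : Set} (P? : Dec P) → 𝟙 P? + 𝟙 (¬? P?) ≡ 1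
𝟙-∁ (yes _) = refl
𝟙-∁ (no _)  = refl

𝟙-⊆ : {P Q : Set} (P? : Dec P) (Q? : Dec Q) → (P → Q) → 𝟙 Q? ≡ 𝟙 P? + 𝟙 (Q? ×-dec ¬? P?)
𝟙-⊆ (yes _) (yes _) _   = refl
𝟙-⊆ (yes p) (no ¬q) P→Q = contradiction (P→Q p) ¬q
𝟙-⊆ (no _)  (yes _) _   = refl
𝟙-⊆ (no _)  (no _)  _   = refl

∑-𝟙-< : ∀ t p → ∑[ i < t ] 𝟙 (i <? p) ≡ t ⊓ p
∑-𝟙-< zero    p       = refl
∑-𝟙-< (suc t) zero    = trans (∑-cong t (λ i _ → 𝟙-no (suc i <? 0) n≮0)) (∑-zero t)
∑-𝟙-< (suc t) (suc p) = cong suc (trans (∑-cong t (λ i _ → shift i)) (∑-𝟙-< t p))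
  where
  shift : ∀ i → 𝟙 (suc i <? suc p) ≡ 𝟙 (i <? p)
  shift i = 𝟙-cong (suc i <? suc p) (i <? p) (mk⇔ s<s⁻¹ s<s)

∑-𝟙-≟ : ∀ t (f : ℕ → ℕ) {a} → a < t → ∑[ j < t ] (𝟙 (j ≟ a) * f j) ≡ f a
∑-𝟙-≟ (suc t) f {zero} _ = begin
  𝟙 (0 ≟ 0) * f 0 + ∑[ j < t ] (𝟙 (suc j ≟ 0) * f (suc j))
    ≡⟨ cong₂ _+_ (cong (_* f 0) (𝟙-yes (0 ≟ 0) refl))
                 (∑-cong t (λ j _ → cong (_* f (suc j)) (𝟙-no (suc j ≟ 0) λ ()))) ⟩
  1 * f 0 + ∑[ j < t ] 0
    ≡⟨ cong₂ _+_ (*-identityˡ (f 0)) (∑-zero t) ⟩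
  f 0 + 0
    ≡⟨ +-identityʳ (f 0) ⟩
  f 0 ∎
  where open ≡-Reasoning
∑-𝟙-≟ (suc t) f {suc a} (s<s a<t) = cong₂ _+_ (cong (_* f 0) (𝟙-no (0 ≟ suc a) λ ()))
  (trans (∑-cong t (λ j _ → cong (_* f (suc j)) (shift j))) (∑-𝟙-≟ t (f ∘ suc) a<t))
  where
  shift : ∀ j → 𝟙 (suc j ≟ suc a) ≡ 𝟙 (j ≟ a)
  shift j = 𝟙-cong (suc j ≟ suc a) (j ≟ a) (mk⇔ suc-injective (cong suc))

∑-𝟙-∁ : ∀ t {P : Pred ℕ 0ℓ} (P? : Decidable P) (f : ℕ → ℕ) →
        ∑[ j < t ] (𝟙 (P? j) * f j) + ∑[ j < t ] (𝟙 (∁? P? j) * f j) ≡ ∑< t f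
∑-𝟙-∁ t P? f = trans (sym (∑-distrib-+ t _ _)) (∑-cong t (λ j _ → split j))
  where
  split : ∀ j → 𝟙 (P? j) * f j + 𝟙 (∁? P? j) * f j ≡ f j
  split j = trans (sym (*-distribʳ-+ (f j) (𝟙 (P? j)) _))
                  (trans (cong (_* f j) (𝟙-∁ (P? j))) (*-identityˡ (f j)))

DownClosed : Pred ℕ 0ℓ → Set
DownClosed P = ∀ {i j} → i ≤ j → P j → P i

count : ℕ → {P : Pred ℕ 0ℓ} → Decidable P → ℕ
count t P? = ∑[ i < t ] 𝟙 (P? i)

count-downClosed : ∀ t {P : Pred ℕ 0ℓ} (P? : Decidable P) → DownClosed P → ¬ P t →
                   ∀ i → P i ⇔ i < count t P?
count-downClosed zero    P? down ¬Pt i = mk⇔ (λ Pi → contradiction (down z≤n Pi) ¬Pt) λ ()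
count-downClosed (suc t) {P} P? down ¬Pt i with P? 0
... | no ¬P0 = mk⇔ (λ Pi → contradiction (down z≤n Pi) ¬P0)
                   (λ i<c → contradiction (down z≤n (from (shifted i) i<c)) ¬P0)
  where shifted = count-downClosed t (P? ∘ suc) (down ∘ s≤s) ¬Pt
... | yes P0 with i
...   | zero  = mk⇔ (λ _ → z<s) (λ _ → P0)
...   | suc i = mk⇔ (s<s ∘ to (shifted i)) (from (shifted i) ∘ s<s⁻¹)
  where shifted = count-downClosed t (P? ∘ suc) (down ∘ s≤s) ¬Pt

infixl 9 _!_

_!_ : {r : ℕ} → Vec ℕ r → ℕ → ℕ
[]      ! _     = 0
(x ∷ _) ! zero  = x
(_ ∷ v) ! suc i = v ! i

fromFun : (r : ℕ) → (ℕ → ℕ) → Vec ℕ r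
fromFun zero    F = []
fromFun (suc r) F = F 0 ∷ fromFun r (F ∘ suc)

VanishesFrom : ℕ → (ℕ → ℕ) → Set
VanishesFrom r F = ∀ i → r ≤ i → F i ≡ 0

VanishesFrom-mono : ∀ {k r} {F : ℕ → ℕ} → k ≤ r → VanishesFrom k F → VanishesFrom r F
VanishesFrom-mono k≤r F₀ i r≤i = F₀ i (≤-trans k≤r r≤i)

lookup≡! : ∀ {r} (v : Vec ℕ r) (i : Fin r) → lookup v i ≡ v ! toℕ i
lookup≡! (_ ∷ _) Fin.zero    = refl
lookup≡! (_ ∷ v) (Fin.suc i) = lookup≡! v i

head≡!0 : ∀ {r} (v : Vec ℕ (suc r)) → head v ≡ v ! 0
head≡!0 (_ ∷ _) = refl

!-vanishes : ∀ {r} (v : Vec ℕ r) → VanishesFrom r (v !_)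
!-vanishes []      i       _         = refl
!-vanishes (_ ∷ v) (suc i) (s≤s r≤i) = !-vanishes v i r≤i

!-fromFun : ∀ r {F : ℕ → ℕ} → VanishesFrom r F → ∀ i → fromFun r F ! i ≡ F i
!-fromFun zero    F₀ i       = sym (F₀ i z≤n)
!-fromFun (suc r) F₀ zero    = refl
!-fromFun (suc r) F₀ (suc i) = !-fromFun r (λ i r≤i → F₀ (suc i) (s≤s r≤i)) i

!-ext : ∀ {r} (u v : Vec ℕ r) → (∀ i → u ! i ≡ v ! i) → u ≡ v
!-ext []      []      _   = refl
!-ext (x ∷ u) (y ∷ v) u≗v = cong₂ _∷_ (u≗v 0) (!-ext u v (u≗v ∘ suc))

!-⊕ : ∀ {r} (u v : Vec ℕ r) i → (u ⊕ v) ! i ≡ u ! i + v ! i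
!-⊕ []      []      _       = refl
!-⊕ (_ ∷ _) (_ ∷ _) zero    = refl
!-⊕ (_ ∷ u) (_ ∷ v) (suc i) = !-⊕ u v i

!-fromFun-⊕ : ∀ r {F G : ℕ → ℕ} → VanishesFrom r F → VanishesFrom r G →
              ∀ i → (fromFun r F ⊕ fromFun r G) ! i ≡ F i + G i
!-fromFun-⊕ r F₀ G₀ i =
  trans (!-⊕ (fromFun r _) (fromFun r _) i) (cong₂ _+_ (!-fromFun r F₀ i) (!-fromFun r G₀ i))

psum≡∑ : ∀ {r} t (v : Vec ℕ r) → psum t v ≡ ∑< t (v !_)
psum≡∑ zero    v       = refl
psum≡∑ (suc t) []      = sym (∑-zero t)
psum≡∑ (suc t) (x ∷ v) = cong (x +_) (psum≡∑ t v)

size≡∑ : ∀ {r} (v : Vec ℕ r) → size v ≡ ∑< r (v !_)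
size≡∑ []      = refl
size≡∑ (x ∷ v) = cong (x +_) (size≡∑ v)

!≡lookup-fromℕ< : ∀ {r} (v : Vec ℕ r) {i} (i<r : i < r) → v ! i ≡ lookup v (fromℕ< i<r)
!≡lookup-fromℕ< v i<r = sym (trans (lookup≡! v _) (cong (v !_) (toℕ-fromℕ< i<r)))

partition⇒antitone : ∀ {r} (v : Vec ℕ r) → IsPartition v → Antitonic₁ _≤_ _≤_ (v !_)
partition⇒antitone {r} v v-part {j} {i} i≤j with j <? r
... | no  j≮r = subst (_≤ v ! i) (sym (!-vanishes v j (≮⇒≥ j≮r))) z≤n
... | yes j<r = subst₂ _≤_ (sym (!≡lookup-fromℕ< v j<r)) (sym (!≡lookup-fromℕ< v i<r))
                  (v-part _ _ (subst₂ _≤_ (sym (toℕ-fromℕ< i<r)) (sym (toℕ-fromℕ< j<r)) i≤j))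
  where i<r = ≤-<-trans i≤j j<r

antitone⇒partition : ∀ {r} (v : Vec ℕ r) → Antitonic₁ _≤_ _≤_ (v !_) → IsPartition v
antitone⇒partition v v↓ i j i≤j = subst₂ _≤_ (sym (lookup≡! v j)) (sym (lookup≡! v i)) (v↓ i≤j)

rectangle⇒! : ∀ {r} (v : Vec ℕ r) → IsRectangle v → ∀ {i j} → i < r → j < r →
              v ! i ≢ 0 → v ! j ≢ 0 → v ! i ≡ v ! j
rectangle⇒! v v-rect i<r j<r vᵢ≢0 vⱼ≢0 =
  subst₂ _≡_ (sym (!≡lookup-fromℕ< v i<r)) (sym (!≡lookup-fromℕ< v j<r))
    (v-rect _ _ (vᵢ≢0 ∘ trans (!≡lookup-fromℕ< v i<r)) (vⱼ≢0 ∘ trans (!≡lookup-fromℕ< v j<r)))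

constant⇒rectangle : ∀ {r} (v : Vec ℕ r) c → (∀ i → v ! i ≢ 0 → v ! i ≡ c) → IsRectangle v
constant⇒rectangle v c v≡c i j vᵢ≢0 vⱼ≢0 = begin
  lookup v i   ≡⟨ lookup≡! v i ⟩
  v ! toℕ i    ≡⟨ v≡c (toℕ i) (vᵢ≢0 ∘ trans (lookup≡! v i)) ⟩
  c            ≡⟨ v≡c (toℕ j) (vⱼ≢0 ∘ trans (lookup≡! v j)) ⟨
  v ! toℕ j    ≡⟨ lookup≡! v j ⟨
  lookup v j   ∎
  where open ≡-Reasoning

module _ (r : ℕ) {F : ℕ → ℕ} (F₀ : VanishesFrom r F) where

  fromFun-partition : Antitonic₁ _≤_ _≤_ F → IsPartition (fromFun r F)
  fromFun-partition F↓ = antitone⇒partition (fromFun r F)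
    (λ {j} {i} i≤j → subst₂ _≤_ (sym (!-fromFun r F₀ j)) (sym (!-fromFun r F₀ i)) (F↓ i≤j))

  psum-fromFun : ∀ t → psum t (fromFun r F) ≡ ∑< t F
  psum-fromFun t = trans (psum≡∑ t (fromFun r F)) (∑-cong t (λ i _ → !-fromFun r F₀ i))

  size-fromFun : size (fromFun r F) ≡ ∑< r F
  size-fromFun = trans (size≡∑ (fromFun r F)) (∑-cong r (λ i _ → !-fromFun r F₀ i))

fromFun-inKostka : ∀ r {F G : ℕ → ℕ} → VanishesFrom r F → VanishesFrom r G →
                   Antitonic₁ _≤_ _≤_ F → Antitonic₁ _≤_ _≤_ G →
                   ∑< r F ≡ ∑< r G → (∀ t → ∑< t G ≤ ∑< t F) →
                   InKostka r (fromFun r F) (fromFun r G)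
fromFun-inKostka r F₀ G₀ F↓ G↓ |F|≡|G| G≼F =
    fromFun-partition r F₀ F↓
  , fromFun-partition r G₀ G↓
  , trans (size-fromFun r F₀) (trans |F|≡|G| (sym (size-fromFun r G₀)))
  , λ t → subst₂ _≤_ (sym (psum-fromFun r G₀ t)) (sym (psum-fromFun r F₀ t)) (G≼F t)

Decomposable : (r : ℕ) → Vec ℕ r → Vec ℕ r → Set
Decomposable r l m =
  Σ (Vec ℕ r) λ l₁ → Σ (Vec ℕ r) λ m₁ → Σ (Vec ℕ r) λ l₂ → Σ (Vec ℕ r) λ m₂ →
    InKostka r l₁ m₁ × ¬ IsZeroPair l₁ m₁ ×
    InKostka r l₂ m₂ × ¬ IsZeroPair l₂ m₂ ×
    l ≡ l₁ ⊕ l₂ × m ≡ m₁ ⊕ m₂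

rect : ℕ → ℕ → ℕ → ℕ
rect c k i = c * 𝟙 (i <? k)

∑-rect : ∀ c k t → ∑< t (rect c k) ≡ c * (t ⊓ k)
∑-rect c k t = trans (∑-distribˡ-* t c _) (cong (c *_) (∑-𝟙-< t k))

rect-antitone : ∀ c k → Antitonic₁ _≤_ _≤_ (rect c k)
rect-antitone c k i≤j = *-monoʳ-≤ c (𝟙-mono (_ <? k) (_ <? k) (≤-<-trans i≤j))

rect-vanishes : ∀ c k → VanishesFrom k (rect c k)
rect-vanishes c k i k≤i = trans (cong (c *_) (𝟙-no (i <? k) (≤⇒≯ k≤i))) (*-zeroʳ c)

[m⊓o]*n≤o*[m⊓n] : ∀ m {n o} → n ≤ o → (m ⊓ o) * n ≤ o * (m ⊓ n)
[m⊓o]*n≤o*[m⊓n] m {n} {o} n≤o with ≤-total m n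
... | inj₁ m≤n rewrite m≤n⇒m⊓n≡m m≤n | m≤n⇒m⊓n≡m (≤-trans m≤n n≤o) =
  subst (m * n ≤_) (*-comm m o) (*-monoʳ-≤ m n≤o)
... | inj₂ n≤m rewrite m≥n⇒m⊓n≡n n≤m = *-monoˡ-≤ n (m⊓n≤n m o)

m%n≡[m+o]%n⇒n∣o : ∀ m o n .{{_ : NonZero n}} → m % n ≡ (m + o) % n → n ∣ o
m%n≡[m+o]%n⇒n∣o m o n eq = divides (q₂ ∸ q₁) (begin
  o                    ≡⟨ m+n∸m≡n (q₁ * n) o ⟨
  q₁ * n + o ∸ q₁ * n  ≡⟨ cong (_∸ q₁ * n) (+-cancelˡ-≡ (m % n) _ _ same-remainder) ⟩
  q₂ * n ∸ q₁ * n      ≡⟨ *-distribʳ-∸ n q₂ q₁ ⟨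
  (q₂ ∸ q₁) * n        ∎)
  where
  open ≡-Reasoning
  q₁ = m / n
  q₂ = (m + o) / n
  same-remainder : m % n + (q₁ * n + o) ≡ m % n + q₂ * n
  same-remainder = begin
    m % n + (q₁ * n + o)  ≡⟨ +-assoc (m % n) _ o ⟨
    m % n + q₁ * n + o    ≡⟨ cong (_+ o) (m≡m%n+[m/n]*n m n) ⟨
    m + o                 ≡⟨ m≡m%n+[m/n]*n (m + o) n ⟩
    (m + o) % n + q₂ * n  ≡⟨ cong (_+ q₂ * n) eq ⟨
    m % n + q₂ * n        ∎

pigeonhole-% : ∀ k .{{_ : NonZero k}} (f : ℕ → ℕ) →
               ∃₂ λ i j → i < j × j ≤ k × f i % k ≡ f j % k
pigeonhole-% k f with pigeonhole (n<1+n k) (λ i → f (toℕ i) mod k)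
... | i , j , i<j , fᵢ≡fⱼ = toℕ i , toℕ j , i<j , s≤s⁻¹ (toℕ<n j) ,
  trans (sym (toℕ-fromℕ< _)) (trans (cong toℕ fᵢ≡fⱼ) (toℕ-fromℕ< _))

-- rows P? is the partition whose Young diagram consists of the columns j < r with P j,
-- column j having h j cells; weight P? is its size.
module Columns (r : ℕ) (h : ℕ → ℕ) where

  weight : {P : Pred ℕ 0ℓ} → Decidable P → ℕ
  weight P? = ∑[ j < r ] (𝟙 (P? j) * h j)

  rows : {P : Pred ℕ 0ℓ} → Decidable P → ℕ → ℕ
  rows P? i = ∑[ j < r ] (𝟙 (P? j) * 𝟙 (i <? h j))

  module _ {P : Pred ℕ 0ℓ} (P? : Decidable P) where

    rows-antitone : Antitonic₁ _≤_ _≤_ (rows P?)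
    rows-antitone i≤i′ =
      ∑-mono-≤ r (λ j _ → *-monoʳ-≤ (𝟙 (P? j)) (𝟙-mono (_ <? h j) (_ <? h j) (≤-<-trans i≤i′)))

    rows-vanishes : ∀ {k} → (∀ j → j < r → h j ≤ k) → VanishesFrom k (rows P?)
    rows-vanishes h≤k i k≤i = trans (∑-cong r (λ j j<r → short j j<r)) (∑-zero r)
      where
      short : ∀ j → j < r → 𝟙 (P? j) * 𝟙 (i <? h j) ≡ 0
      short j j<r = trans (cong (𝟙 (P? j) *_) (𝟙-no (i <? h j) i≮h)) (*-zeroʳ (𝟙 (P? j)))
        where i≮h = λ i<h → <⇒≱ (<-≤-trans i<h (h≤k j j<r)) k≤i

    ∑-rows : ∀ t → ∑[ i < t ] rows P? i ≡ ∑[ j < r ] (𝟙 (P? j) * (t ⊓ h j))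
    ∑-rows t = begin
      ∑[ i < t ] ∑[ j < r ] (𝟙 (P? j) * 𝟙 (i <? h j))
        ≡⟨ ∑-comm t r _ ⟩
      ∑[ j < r ] ∑[ i < t ] (𝟙 (P? j) * 𝟙 (i <? h j))
        ≡⟨ ∑-cong r (λ j _ → ∑-distribˡ-* t (𝟙 (P? j)) _) ⟩
      ∑[ j < r ] (𝟙 (P? j) * ∑[ i < t ] 𝟙 (i <? h j))
        ≡⟨ ∑-cong r (λ j _ → cong (𝟙 (P? j) *_) (∑-𝟙-< t (h j))) ⟩
      ∑[ j < r ] (𝟙 (P? j) * (t ⊓ h j))
        ∎
      where open ≡-Reasoning

    rect-≼-rows : ∀ {k} .{{_ : NonZero k}} → (∀ j → j < r → h j ≤ k) →
                  ∀ q → weight P? ≡ q * k → ∀ t → ∑< t (rect q k) ≤ ∑[ i < t ] rows P? i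
    rect-≼-rows {k} h≤k q weight≡qk t = *-cancelˡ-≤ k (begin
      k * ∑< t (rect q k)                          ≡⟨ cong (k *_) (∑-rect q k t) ⟩
      k * (q * (t ⊓ k))                            ≡⟨ *-left-comm k q (t ⊓ k) ⟩
      q * (k * (t ⊓ k))                            ≡⟨ cong (q *_) (*-comm k (t ⊓ k)) ⟩
      q * ((t ⊓ k) * k)                            ≡⟨ *-left-comm q (t ⊓ k) k ⟩
      (t ⊓ k) * (q * k)                            ≡⟨ cong ((t ⊓ k) *_) weight≡qk ⟨
      (t ⊓ k) * weight P?                          ≡⟨ ∑-distribˡ-* r (t ⊓ k) _ ⟨
      ∑[ j < r ] ((t ⊓ k) * (𝟙 (P? j) * h j))      ≤⟨ ∑-mono-≤ r column-bound ⟩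
      ∑[ j < r ] (k * (𝟙 (P? j) * (t ⊓ h j)))      ≡⟨ ∑-distribˡ-* r k _ ⟩
      k * ∑[ j < r ] (𝟙 (P? j) * (t ⊓ h j))        ≡⟨ cong (k *_) (∑-rows t) ⟨
      k * ∑[ i < t ] rows P? i                     ∎)
      where
      open ≤-Reasoning
      column-bound : ∀ j → j < r → (t ⊓ k) * (𝟙 (P? j) * h j) ≤ k * (𝟙 (P? j) * (t ⊓ h j))
      column-bound j j<r = begin
        (t ⊓ k) * (𝟙 (P? j) * h j)  ≡⟨ *-left-comm (t ⊓ k) (𝟙 (P? j)) (h j) ⟩
        𝟙 (P? j) * ((t ⊓ k) * h j)  ≤⟨ *-monoʳ-≤ (𝟙 (P? j)) ([m⊓o]*n≤o*[m⊓n] t (h≤k j j<r)) ⟩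
        𝟙 (P? j) * (k * (t ⊓ h j))  ≡⟨ *-left-comm (𝟙 (P? j)) k (t ⊓ h j) ⟩
        k * (𝟙 (P? j) * (t ⊓ h j))  ∎

    rows-inKostka : ∀ {k} .{{_ : NonZero k}} → k ≤ r → (∀ j → j < r → h j ≤ k) →
                    ∀ q → weight P? ≡ q * k → InKostka r (fromFun r (rows P?)) (fromFun r (rect q k))
    rows-inKostka {k} k≤r h≤k q weight≡qk =
      fromFun-inKostka r (VanishesFrom-mono k≤r (rows-vanishes h≤k))
                         (VanishesFrom-mono k≤r (rect-vanishes q k))
                         rows-antitone (rect-antitone q k) same-size (rect-≼-rows h≤k q weight≡qk)
      where
      open ≡-Reasoning
      r⊓hⱼ≡hⱼ : ∀ j → j < r → r ⊓ h j ≡ h j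
      r⊓hⱼ≡hⱼ j j<r = m≥n⇒m⊓n≡n (≤-trans (h≤k j j<r) k≤r)
      same-size : ∑< r (rows P?) ≡ ∑< r (rect q k)
      same-size = begin
        ∑< r (rows P?)                      ≡⟨ ∑-rows r ⟩
        ∑[ j < r ] (𝟙 (P? j) * (r ⊓ h j))  ≡⟨ ∑-cong r (λ j j<r → cong (𝟙 (P? j) *_) (r⊓hⱼ≡hⱼ j j<r)) ⟩
        weight P?                           ≡⟨ weight≡qk ⟩
        q * k                               ≡⟨ cong (q *_) (m≥n⇒m⊓n≡n k≤r) ⟨
        q * (r ⊓ k)                         ≡⟨ ∑-rect q k r ⟨
        ∑< r (rect q k)                     ∎

    rows-positive : ∀ {j} → j < r → P j → 0 < h j → 0 < rows P? 0
    rows-positive {j} j<r Pj 0<hⱼ = <-≤-trans (subst (0 <_) (sym cell) z<s) (≤-∑ r _ j<r)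
      where
      cell : 𝟙 (P? j) * 𝟙 (0 <? h j) ≡ 1
      cell = cong₂ _*_ (𝟙-yes (P? j) Pj) (𝟙-yes (0 <? h j) 0<hⱼ)

  weight-⊆ : ∀ {P Q : Pred ℕ 0ℓ} (P? : Decidable P) (Q? : Decidable Q) → P ⊆ Q →
             weight Q? ≡ weight P? + weight (Q? ∩? ∁? P?)
  weight-⊆ P? Q? P⊆Q = trans (∑-cong r (λ j _ → split j)) (∑-distrib-+ r _ _)
    where
    split : ∀ j → 𝟙 (Q? j) * h j ≡ 𝟙 (P? j) * h j + 𝟙 ((Q? ∩? ∁? P?) j) * h j
    split j = trans (cong (_* h j) (𝟙-⊆ (P? j) (Q? j) P⊆Q)) (*-distribʳ-+ (h j) (𝟙 (P? j)) _)

  record DivisibleColumnSet (k : ℕ) : Set₁ where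
    field
      P         : Pred ℕ 0ℓ
      P?        : Decidable P
      member    : ∃ λ j → j < r × P j
      nonMember : ∃ λ j → j < r × ¬ P j
      divisible : k ∣ weight P?

  divisible-difference : ∀ {k} .{{_ : NonZero k}} {P Q : Pred ℕ 0ℓ} (P? : Decidable P) (Q? : Decidable Q) →
                         P ⊆ Q → weight P? % k ≡ weight Q? % k →
                         (∃ λ j → j < r × Q j × ¬ P j) → (∃ λ j → j < r × ¬ (Q j × ¬ P j)) →
                         DivisibleColumnSet k
  divisible-difference {k} P? Q? P⊆Q same-residue member nonMember = record
    { P?        = Q? ∩? ∁? P?
    ; member    = member
    ; nonMember = nonMember
    ; divisible = m%n≡[m+o]%n⇒n∣o (weight P?) _ k (trans same-residue (cong (_% k) (weight-⊆ P? Q? P⊆Q)))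
    }

module ZeroSum (n : ℕ) (h : ℕ → ℕ) where

  open Columns (suc n) h

  chain : ℕ → Pred ℕ 0ℓ
  chain zero    = ∅
  chain (suc s) = (_≡ n) ∪ (_< s)

  chain? : ∀ s → Decidable (chain s)
  chain? zero    = ∅?
  chain? (suc s) = (_≟ n) ∪? (_<? s)

  chain-mono : ∀ {s s′} → s ≤ s′ → chain s ⊆ chain s′
  chain-mono {zero} _ ()
  chain-mono {suc s} {suc s′} (s≤s s≤s′) = map₂ (λ j<s → <-≤-trans j<s s≤s′)

  chain-excludes : ∀ {s} → s < n → ¬ chain (suc s) s
  chain-excludes s<n = [ (λ s≡n → <-irrefl s≡n s<n) , <-irrefl refl ]

  weight-chain₁ : weight (chain? 1) ≡ h n
  weight-chain₁ = trans (∑-cong (suc n) (λ j _ → cong (_* h j) (𝟙-cong (chain? 1 j) (j ≟ n) only-n)))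
                        (∑-𝟙-≟ (suc n) h (n<1+n n))
    where
    only-n : ∀ {j} → chain 1 j ⇔ (j ≡ n)
    only-n = mk⇔ [ (λ j≡n → j≡n) , (λ ()) ] inj₁

  weight-column₀ : weight (_≟ 0) ≡ h 0
  weight-column₀ = ∑-𝟙-≟ (suc n) h z<s

  -- Any two of the k + 1 candidates {0}, ∅, {n}, {n, 0}, {n, 0, 1}, … other than {0} and {n}
  -- are nested, with a difference that is neither empty nor all columns.
  candidate : ℕ → Pred ℕ 0ℓ
  candidate zero    = _≡ 0
  candidate (suc s) = chain s

  candidate? : ∀ s → Decidable (candidate s)
  candidate? zero    = _≟ 0
  candidate? (suc s) = chain? s

  module _ {k} .{{_ : NonZero k}} (k≤r : k ≤ suc n)
           (0<hₙ : 0 < h n) (hₙ<h₀ : h n < h 0) (h₀≤k : h 0 ≤ k) where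

    n≢0 : n ≢ 0
    n≢0 refl = <-irrefl refl hₙ<h₀

    h₀≢hₙ-mod : h 0 % k ≢ h n % k
    h₀≢hₙ-mod h₀≡hₙ = <⇒≱ gap<k (∣⇒≤ {{>-nonZero 0<gap}} k∣gap)
      where
      gap = h 0 ∸ h n
      0<gap : 0 < gap
      0<gap = m<n⇒0<n∸m hₙ<h₀
      gap<k : gap < k
      gap<k = <-≤-trans (∸-monoʳ-< 0<hₙ (<⇒≤ hₙ<h₀)) h₀≤k
      k∣gap : k ∣ gap
      k∣gap = m%n≡[m+o]%n⇒n∣o (h n) gap k
                (trans (sym h₀≡hₙ) (cong (_% k) (sym (m+[n∸m]≡n (<⇒≤ hₙ<h₀)))))

    chain-difference : ∀ {s s′} → s < s′ → s′ < k →
                       weight (chain? s) % k ≡ weight (chain? s′) % k →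
                       DivisibleColumnSet k
    chain-difference {zero} {suc s₁} _ s′<k same =
      divisible-difference (chain? 0) (chain? (suc s₁)) (chain-mono {s′ = suc s₁} z≤n) same
        (n , n<1+n n , inj₁ refl , λ ())
        (s₁ , m<n⇒m<1+n s₁<n , λ (s₁∈ , _) → chain-excludes s₁<n s₁∈)
      where s₁<n = s≤s⁻¹ (≤-trans s′<k k≤r)
    chain-difference {suc s₀} {suc s₁} (s<s s₀<s₁) s′<k same =
      divisible-difference (chain? (suc s₀)) (chain? (suc s₁)) (chain-mono (s≤s (<⇒≤ s₀<s₁))) same
        (s₀ , m<n⇒m<1+n s₀<n , inj₂ s₀<s₁ , chain-excludes s₀<n)
        (n , n<1+n n , λ (_ , n∉) → n∉ (inj₁ refl))
      where s₀<n = <-trans s₀<s₁ (s≤s⁻¹ (≤-trans s′<k k≤r))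

    divisibleColumnSet : DivisibleColumnSet k
    divisibleColumnSet with pigeonhole-% k (weight ∘ candidate?)
    ... | zero  , zero , () , _
    ... | suc _ , zero , () , _
    ... | zero  , suc zero , _ , _ , same =
      divisible-difference (chain? 0) (_≟ 0) (λ ()) (sym same)
        (0 , z<s , refl , λ ())
        (n , n<1+n n , λ (n≡0 , _) → n≢0 n≡0)
    ... | zero  , suc (suc zero) , _ , _ , same =
      contradiction (trans (cong (_% k) (sym weight-column₀)) (trans same (cong (_% k) weight-chain₁)))
                    h₀≢hₙ-mod
    ... | zero  , suc (suc (suc s)) , _ , _ , same =
      divisible-difference (_≟ 0) (chain? (suc (suc s))) (λ { refl → inj₂ z<s }) same
        (n , n<1+n n , inj₁ refl , n≢0)
        (0 , z<s , λ (_ , 0≢0) → 0≢0 refl)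
    ... | suc s , suc s′ , s<s s<s′ , s′<k , same = chain-difference s<s′ s′<k same

module OverRectangle (n : ℕ) (l m : Vec ℕ (suc n))
                     (l-partition : IsPartition l) (m-partition : IsPartition m)
                     (|l|≡|m| : size l ≡ size m) (m≼l : ∀ t → psum t m ≤ psum t l)
                     (l₁≡r : head l ≡ suc n) (m-rectangle : IsRectangle m) where

  r : ℕ
  r = suc n

  L M : ℕ → ℕ
  L = l !_
  M = m !_

  L-antitone : Antitonic₁ _≤_ _≤_ L
  L-antitone = partition⇒antitone l l-partition

  M-antitone : Antitonic₁ _≤_ _≤_ M
  M-antitone = partition⇒antitone m m-partition

  ∑L≡∑M : ∑< r L ≡ ∑< r M
  ∑L≡∑M = trans (sym (size≡∑ l)) (trans |l|≡|m| (size≡∑ m))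

  ∑M≤∑L : ∀ t → ∑< t M ≤ ∑< t L
  ∑M≤∑L t = subst₂ _≤_ (psum≡∑ t m) (psum≡∑ t l) (m≼l t)

  L₀≡r : L 0 ≡ r
  L₀≡r = trans (sym (head≡!0 l)) l₁≡r

  L≤r : ∀ i → L i ≤ r
  L≤r i = subst (L i ≤_) L₀≡r (L-antitone z≤n)

  k : ℕ
  k = count r (λ i → 0 <? M i)

  M-support : ∀ i → 0 < M i ⇔ i < k
  M-support = count-downClosed r (λ i → 0 <? M i) (λ i≤j 0<Mⱼ → <-≤-trans 0<Mⱼ (M-antitone i≤j))
                               (n≮0 ∘ subst (0 <_) (!-vanishes m r ≤-refl))

  k≤r : k ≤ r
  k≤r = ≮⇒≥ (n≮0 ∘ subst (0 <_) (!-vanishes m r ≤-refl) ∘ from (M-support r))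

  c : ℕ
  c = M 0

  M≡rect : ∀ i → M i ≡ rect c k i
  M≡rect i with i <? k
  ... | yes i<k = trans (rectangle⇒! m m-rectangle (<-≤-trans i<k k≤r) z<s
                                     (nonzero i<k) (nonzero (≤-<-trans z≤n i<k)))
                        (sym (*-identityʳ c))
    where nonzero = λ {j} j<k → >⇒≢ (from (M-support j) j<k)
  ... | no  i≮k = trans (n≤0⇒n≡0 (≮⇒≥ (i≮k ∘ to (M-support i))))
                        (sym (*-zeroʳ c))

  ∑M≡ck : ∀ {t} → k ≤ t → ∑< t M ≡ c * k
  ∑M≡ck {t} k≤t =
    trans (∑-cong t (λ i _ → M≡rect i)) (trans (∑-rect c k t) (cong (c *_) (m≥n⇒m⊓n≡n k≤t)))

  -- Since the first k parts of λ already sum to |μ| = ck, all later parts vanish.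
  L-vanishes : VanishesFrom k L
  L-vanishes i k≤i with i <? r
  ... | no  i≮r = !-vanishes l i (≮⇒≥ i≮r)
  ... | yes i<r = subst (λ i → L i ≡ 0) (m+[n∸m]≡n k≤i)
                        (∑≡0⇒≡0 (r ∸ k) (λ j → L (k + j)) tail≡0 (i ∸ k) (∸-monoˡ-< i<r k≤i))
    where
    open ≤-Reasoning
    tail≡0 : ∑[ j < r ∸ k ] L (k + j) ≡ 0
    tail≡0 = n≤0⇒n≡0 (+-cancelˡ-≤ (∑< k L) _ 0 (begin
      ∑< k L + ∑[ j < r ∸ k ] L (k + j)  ≡⟨ ∑-split k (r ∸ k) L ⟨
      ∑< (k + (r ∸ k)) L                 ≡⟨ cong (λ t → ∑< t L) (m+[n∸m]≡n k≤r) ⟩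
      ∑< r L                             ≡⟨ trans ∑L≡∑M (∑M≡ck k≤r) ⟩
      c * k                              ≡⟨ ∑M≡ck ≤-refl ⟨
      ∑< k M                             ≤⟨ ∑M≤∑L k ⟩
      ∑< k L                             ≡⟨ +-identityʳ _ ⟨
      ∑< k L + 0                         ∎))

  instance
    k-nonZero : NonZero k
    k-nonZero = ≢-nonZero (λ k≡0 → 1+n≢0 (trans (sym L₀≡r) (L-vanishes 0 (≤-reflexive k≡0))))

  h : ℕ → ℕ
  h j = count r (λ i → j <? L i)

  column : ∀ j i → j < L i ⇔ i < h j
  column j = count-downClosed r (λ i → j <? L i) (λ i≤i′ j<Lᵢ′ → <-≤-trans j<Lᵢ′ (L-antitone i≤i′))
                              (n≮0 ∘ subst (j <_) (!-vanishes l r ≤-refl))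

  h≤k : ∀ j → h j ≤ k
  h≤k j = ≮⇒≥ (n≮0 ∘ subst (j <_) (L-vanishes k ≤-refl) ∘ from (column j k))

  0<h : ∀ {j} → j < r → 0 < h j
  0<h j<r = to (column _ 0) (subst (_ <_) (sym L₀≡r) j<r)

  L≡∑columns : ∀ i → L i ≡ ∑[ j < r ] 𝟙 (i <? h j)
  L≡∑columns i = begin
    L i                       ≡⟨ m≥n⇒m⊓n≡n (L≤r i) ⟨
    r ⊓ L i                   ≡⟨ ∑-𝟙-< r (L i) ⟨
    ∑[ j < r ] 𝟙 (j <? L i)   ≡⟨ ∑-cong r (λ j _ → 𝟙-cong (j <? L i) (i <? h j) (column j i)) ⟩
    ∑[ j < r ] 𝟙 (i <? h j)   ∎
    where open ≡-Reasoning

  ∑h≡ck : ∑< r h ≡ c * k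
  ∑h≡ck = begin
    ∑[ j < r ] ∑[ i < r ] 𝟙 (j <? L i)  ≡⟨ ∑-comm r r (λ i j → 𝟙 (j <? L i)) ⟨
    ∑[ i < r ] ∑[ j < r ] 𝟙 (j <? L i)  ≡⟨ ∑-cong r (λ i _ → trans (∑-𝟙-< r (L i)) (m≥n⇒m⊓n≡n (L≤r i))) ⟩
    ∑< r L                              ≡⟨ ∑L≡∑M ⟩
    ∑< r M                              ≡⟨ ∑M≡ck k≤r ⟩
    c * k                               ∎
    where open ≡-Reasoning

  hₙ<h₀ : ¬ IsRectangle l → h n < h 0
  hₙ<h₀ l-not-rectangle with h n <? h 0
  ... | yes hₙ<h₀ = hₙ<h₀
  ... | no  hₙ≮h₀ = contradiction (constant⇒rectangle l r full) l-not-rectangle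
    where
    full : ∀ i → L i ≢ 0 → L i ≡ r
    full i Lᵢ≢0 = ≤-antisym (L≤r i) (from (column n i) (<-≤-trans i<h₀ (≮⇒≥ hₙ≮h₀)))
      where i<h₀ = to (column 0 i) (n≢0⇒n>0 Lᵢ≢0)

  open Columns r h

  rows-vanish : ∀ {P : Pred ℕ 0ℓ} (P? : Decidable P) → VanishesFrom r (rows P?)
  rows-vanish P? = VanishesFrom-mono k≤r (rows-vanishes P? (λ j _ → h≤k j))

  rect-vanish : ∀ q → VanishesFrom r (rect q k)
  rect-vanish q = VanishesFrom-mono k≤r (rect-vanishes q k)

  module _ {P : Pred ℕ 0ℓ} (P? : Decidable P) where

    piece-inKostka : ∀ q → weight P? ≡ q * k → InKostka r (fromFun r (rows P?)) (fromFun r (rect q k))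
    piece-inKostka = rows-inKostka P? k≤r (λ j _ → h≤k j)

    piece-nonzero : ∀ q → (∃ λ j → j < r × P j) →
                    ¬ IsZeroPair (fromFun r (rows P?)) (fromFun r (rect q k))
    piece-nonzero q (j , j<r , Pj) (rows≡0 , _) =
      <⇒≢ (rows-positive P? j<r Pj (0<h j<r)) (sym (cong (_! 0) rows≡0))

    l≡rows⊕rows : l ≡ fromFun r (rows P?) ⊕ fromFun r (rows (∁? P?))
    l≡rows⊕rows = !-ext l _ λ i → begin
      L i                                                   ≡⟨ L≡∑columns i ⟩
      ∑[ j < r ] 𝟙 (i <? h j)                               ≡⟨ ∑-𝟙-∁ r P? (λ j → 𝟙 (i <? h j)) ⟨
      rows P? i + rows (∁? P?) i                            ≡⟨ !-fromFun-⊕ r (rows-vanish P?) (rows-vanish (∁? P?)) i ⟨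
      (fromFun r (rows P?) ⊕ fromFun r (rows (∁? P?))) ! i  ∎
      where open ≡-Reasoning

  m≡rect⊕rect : ∀ a b → a + b ≡ c → m ≡ fromFun r (rect a k) ⊕ fromFun r (rect b k)
  m≡rect⊕rect a b a+b≡c = !-ext m _ λ i → begin
    M i                                            ≡⟨ M≡rect i ⟩
    c * 𝟙 (i <? k)                                 ≡⟨ cong (_* 𝟙 (i <? k)) a+b≡c ⟨
    (a + b) * 𝟙 (i <? k)                           ≡⟨ *-distribʳ-+ (𝟙 (i <? k)) a b ⟩
    rect a k i + rect b k i                        ≡⟨ !-fromFun-⊕ r (rect-vanish a) (rect-vanish b) i ⟨
    (fromFun r (rect a k) ⊕ fromFun r (rect b k)) ! i  ∎
    where open ≡-Reasoning

  decompose : DivisibleColumnSet k → Decomposable r l m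
  decompose S =
      fromFun r (rows P?) , fromFun r (rect a k) , fromFun r (rows (∁? P?)) , fromFun r (rect b k)
    , piece-inKostka P? a (_∣_.equality k∣A) , piece-nonzero P? a member
    , piece-inKostka (∁? P?) b (_∣_.equality k∣B) , piece-nonzero (∁? P?) b nonMember
    , l≡rows⊕rows P? , m≡rect⊕rect a b a+b≡c
    where
    open DivisibleColumnSet S
    k∣A = divisible
    weight-complement : weight P? + weight (∁? P?) ≡ c * k
    weight-complement = trans (∑-𝟙-∁ r P? h) ∑h≡ck
    k∣B : k ∣ weight (∁? P?)
    k∣B = ∣m+n∣m⇒∣n (subst (k ∣_) (sym weight-complement) (n∣m*n c)) k∣A
    a = _∣_.quotient k∣A
    b = _∣_.quotient k∣B
    a+b≡c : a + b ≡ c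
    a+b≡c = *-cancelʳ-≡ (a + b) c k (begin
      (a + b) * k                 ≡⟨ *-distribʳ-+ k a b ⟩
      a * k + b * k               ≡⟨ cong₂ _+_ (_∣_.equality k∣A) (_∣_.equality k∣B) ⟨
      weight P? + weight (∁? P?)  ≡⟨ weight-complement ⟩
      c * k                       ∎)
      where open ≡-Reasoning

lemma3p5 : (n : ℕ) (l m : Vec ℕ (suc n)) →
    InKostka (suc n) l m → head l ≡ suc n → IsRectangle m →
    ¬ IsRectangle l → ¬ IsHilbertBasis (suc n) l m
lemma3p5 n l m (l-partition , m-partition , |l|≡|m| , m≼l) l₁≡r m-rectangle l-not-rectangle
         (_ , _ , indecomposable) =
  indecomposable (decompose (divisibleColumnSet k≤r (0<h (n<1+n n)) (hₙ<h₀ l-not-rectangle) (h≤k 0)))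
  where
  open OverRectangle n l m l-partition m-partition |l|≡|m| m≼l l₁≡r m-rectangle
  open ZeroSum n h
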